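{- Let $M$ be an $n\times n$ $k$-uniform binary matrix. Then $M$ is optimal if and only if the canonical word $w_j$ of $M$ is a Dyck word for every $j$ with $1\le j\le n-1$.
   Context: Biker–hiker model: $n$ travellers $t_1,\dots,t_n$; posts $P_0,\dots,P_n$ at unit spacing; stage $s_j$ is the leg from $P_{j-1}$ to $P_j$. All start at $P_0$ at time $0$, walk at common speed $w$, cycle at common speed $v>w$, mode changes take no time. The $n\times n$ binary matrix $M=(m_{i,j})$ prescribes that $t_i$ cycles $s_j$ iff $m_{i,j}=1$. $M$ is $k$-uniform if every row and column has exactly $k$ ones. Bicycles start at $P_0$, move only when ridden by one rider, and a traveller due to cycle $s_j$ must take a bicycle present at $P_{j-1}$ when he arrives there. $M$ is optimal if it is $k$-uniform for some $k$ and, with $k$ bicycles, the scheme can be executed with no traveller ever waiting for a bicycle. Canonical word: for $1\le j\le n-1$ let $S_{i,j}=\sum_{l=1}^{j}m_{i,l}$, $X_{1,0}^j=\{i:m_{i,j}=1,m_{i,j+1}=0\}$, $X_{0,1}^j=\{i:m_{i,j}=0,m_{i,j+1}=1\}$ (these have the same size $p$ when $M$ is uniform). List the $2p$ elements of $X_{1,0}^j\cup X_{0,1}^j$ in non-increasing order of $S_{i,j}$, where among elements with equal sums those of $X_{1,0}^j$ precede those of $X_{0,1}^j$ (ties within one set broken by index). The canonical word $w_j$ is the word over $\{a,b\}$ whose $r$-th letter is $a$ if the $r$-th listed element lies in $X_{1,0}^j$ and $b$ if it lies in $X_{0,1}^j$. A word $w$ over $\{a,b\}$ is a Dyck word if it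 has equally many $a$'s and $b$'s and every prefix $u$ of $w$ has at least as many $a$'s as $b$'s.
   Formalization: The walking speed $w$ and the cycling speed $v$ are positive rationals. -}

module Defs where

open import Data.Bool using (Bool; true; false; if_then_else_; _∧_; not)
open import Data.Nat as ℕ using (ℕ; zero; suc; _≤_; _∸_)
open import Data.Fin using (Fin; fromℕ<)
open import Data.Nat.ListAction using (sum)
open import Relation.Nullary using (yes; no)
open import Data.List using (List; []; _∷_; _++_; map; filter; allFin; length; take; downFrom; concatMap)
open import Data.Product using (Σ; ∃; _×_; _,_)
open import Data.Integer using (+_)
open import Data.Rational as ℚ using (ℚ; Positive; _÷_; _+_; _*_)
open import Data.Rational.Properties using (pos⇒nonZero)
open import Relation.Binary.PropositionalEquality using (_≡_)
open import Relation.Nullary.Decidable using (⌊_⌋)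

-- An n×n binary matrix: M i l is the entry m_{i+1,l+1} (0-based Fin indices).
Matrix : ℕ → Set
Matrix n = Fin n → Fin n → Bool

count : ∀ {n} → (Fin n → Bool) → ℕ
count {n} f = sum (map (λ l → if f l then 1 else 0) (allFin n))

Uniform : ∀ {n} → ℕ → Matrix n → Set
Uniform {n} k M = (∀ i → count (λ j → M i j) ≡ k) × (∀ j → count (λ i → M i j) ≡ k)

-- entry M i j  =  m_{i,j} for the 1-based stage number j (false outside 1..n)
entry : ∀ {n} → Matrix n → Fin n → ℕ → Bool
entry M i zero = false
entry {n} M i (suc j) with j ℕ.<? n
... | yes j<n = M i (fromℕ< j<n)
... | no _ = false

-- S_{i,j} = m_{i,1} + ... + m_{i,j}: number of the first j stages cycled by t_i
S : ∀ {n} → Matrix n → Fin n → ℕ → ℕ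
S M i zero = 0
S M i (suc j) = S M i j ℕ.+ (if entry M i (suc j) then 1 else 0)

ℕ→ℚ : ℕ → ℚ
ℕ→ℚ m = (+ m) ℚ./ 1

-- Arrival time of traveller t_i at post P_j (walking speed w, cycling speed v,
-- unit spacing, no waiting): walked distance / w + cycled distance / v.
arrival : ∀ {n} → (w v : ℚ) → .{{Positive w}} → .{{Positive v}} →
          Matrix n → Fin n → ℕ → ℚ
arrival {n} w v M i j =
  (_÷_ (ℕ→ℚ (j ∸ S M i j)) w {{pos⇒nonZero w}}) + (_÷_ (ℕ→ℚ (S M i j)) v {{pos⇒nonZero v}})

-- An execution of the scheme M with k bicycles (numbered by Fin k) in which no
-- traveller ever waits.  bike i j p is the bicycle t_i rides on stage s_j.
-- * a bicycle is ridden on a given stage by at most one traveller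
--   (bicycles move only forward and only with one rider);
-- * if t_i rides s_{j+1} with j ≥ 1, the bicycle he takes at P_j must be
--   present there when he arrives: it was brought to P_j (necessarily along s_j)
--   by some t_{i'} arriving at P_j no later than t_i.
-- (At P_0 all bicycles are present at time 0.)
record Execution {n} (w v : ℚ) .{{_ : Positive w}} .{{_ : Positive v}}
                 (M : Matrix n) (k : ℕ) : Set where
  field
    bike      : (i : Fin n) (j : ℕ) → entry M i j ≡ true → Fin k
    oneRider  : ∀ j i i' (p : entry M i j ≡ true) (p' : entry M i' j ≡ true) →
                bike i j p ≡ bike i' j p' → i ≡ i'
    available : ∀ i j (p : entry M i (suc j) ≡ true) → 1 ≤ j →
                Σ (Fin n) λ i' → Σ (entry M i' j ≡ true) λ p' →
                  (bike i' j p' ≡ bike i (suc j) p) ×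
                  (arrival w v M i' j ℚ.≤ arrival w v M i j)

Optimal : ∀ {n} (w v : ℚ) .{{_ : Positive w}} .{{_ : Positive v}} → Matrix n → Set
Optimal w v M = ∃ λ k → Uniform k M × Execution w v M k

data Letter : Set where
  a b : Letter

isA : Letter → Bool
isA a = true
isA b = false

countA countB : List Letter → ℕ
countA u = length (filter (λ x → isA x Data.Bool.≟ true) u)
  where import Data.Bool
countB u = length (filter (λ x → isA x Data.Bool.≟ false) u)
  where import Data.Bool

Dyck : List Letter → Set
Dyck u = (countA u ≡ countB u) × (∀ m → countB (take m u) ≤ countA (take m u))

inX10 inX01 : ∀ {n} → Matrix n → ℕ → Fin n → Bool
inX10 M j i = entry M i j ∧ not (entry M i (suc j))
inX01 M j i = not (entry M i j) ∧ entry M i (suc j)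

-- The listing of X_{1,0}^j ∪ X_{0,1}^j: for s = j, j-1, ..., 0 (the possible values
-- of S_{i,j}, in decreasing order) first the elements of X_{1,0}^j with S_{i,j} = s,
-- then those of X_{0,1}^j with S_{i,j} = s, each group in increasing index order.
listing : ∀ {n} → Matrix n → ℕ → List (Fin n × Letter)
listing {n} M j = concatMap group (downFrom (suc j))
  where
  hasS : ℕ → Fin n → Bool
  hasS s i = ⌊ S M i j ℕ.≟ s ⌋
  group : ℕ → List (Fin n × Letter)
  group s = map (λ i → i , a) (filter (λ i → (inX10 M j i ∧ hasS s i) Data.Bool.≟ true) (allFin n))
         ++ map (λ i → i , b) (filter (λ i → (inX01 M j i ∧ hasS s i) Data.Bool.≟ true) (allFin n))
    where import Data.Bool

canonicalWord : ∀ {n} → Matrix n → ℕ → List Letter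
canonicalWord M j = map (λ { (_ , x) → x }) (listing M j)

-- At post P_j a traveller's arrival time is a strictly decreasing function of the number S of
-- stages he has cycled so far, so riders can be compared by S alone.  Stage s_{j+1} can start
-- without waiting iff for every s at most as many of its riders have S ≥ s as riders of s_j do
-- (a Hall condition): necessity because the bicycles taken at P_j are distinct bicycles brought
-- there earlier, sufficiency because the r-th rider of s_{j+1}, in order of arrival, may take the
-- bicycle of the r-th rider of s_j.  Discarding the travellers who ride both stages, the condition
-- compares X_{0,1}^j and X_{1,0}^j level by level.  Since w_j = a^{x_j} b^{y_j} ⋯ a^{x_0} b^{y_0},
-- where x_s and y_s count the elements of X_{1,0}^j and X_{0,1}^j with S = s, these comparisons are
-- exactly the ballot conditions at the ends of its b-blocks.  Column uniformity makes X_{1,0}^j and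
-- X_{0,1}^j equinumerous, so w_j is balanced.

module Submission where

open import Defs

open import Algebra.Properties.CommutativeSemigroup as CSemigroupProperties using ()
open import Axiom.UniquenessOfIdentityProofs using (module Decidable⇒UIP)
open import Data.Bool as Bool using (Bool; true; false; _∧_; not; if_then_else_)
open import Data.Bool.Properties using (∧-zeroʳ; ∧-identityʳ)
open import Data.Empty using (⊥-elim)
open import Data.Fin as Fin using (Fin; zero; suc; fromℕ<)
import Data.Fin.Properties as Finₚ
import Data.Integer as ℤ
import Data.Integer.Properties as ℤₚ
open import Data.List
  using (List; []; _∷_; _++_; map; filter; length; take; replicate; tabulate; allFin; downFrom; concatMap)
import Data.List.Properties as Listₚ
open import Data.Nat as ℕ using (ℕ; zero; suc; _+_; _∸_; _≤_; _<_; z≤n; s≤s; _≤?_; _≟_)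
import Data.Nat.Properties as ℕₚ
open import Data.Nat.ListAction using (sum)
open import Data.Product using (Σ; ∃; _×_; _,_; proj₁; proj₂)
open import Data.Rational as ℚ using (ℚ; 1ℚ; Positive; NonZero; toℚᵘ; 1/_)
import Data.Rational.Properties as ℚₚ
open import Data.Rational.Solver using (module +-*-Solver)
open import Data.Rational.Unnormalised as ℚᵘ using (mkℚᵘ; *≡*)
import Data.Rational.Unnormalised.Properties as ℚᵘₚ
open import Data.Sum using (_⊎_; inj₁; inj₂)
open import Function using (_∘_; _⇔_; mk⇔; Equivalence)
open import Level using (0ℓ)
open import Relation.Binary using (Rel; IsStrictTotalOrder; Tri; tri<; tri≈; tri>)
open import Relation.Binary.PropositionalEquality
open import Relation.Nullary using (Dec; yes; no; does; ¬_)
open import Relation.Nullary.Decidable using (⌊_⌋; dec-true; dec-false; _×-dec_)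

open Equivalence using (to; from)
open CSemigroupProperties ℕₚ.+-commutativeSemigroup using (interchange; xy∙z≈y∙xz)

private
  variable
    n m : ℕ

does-true : ∀ {A : Set} (a? : Dec A) → does a? ≡ true → A
does-true (yes x) _ = x

∧-true⁻ : ∀ {x y} → x ∧ y ≡ true → x ≡ true × y ≡ true
∧-true⁻ {true} y≡true = refl , y≡true

∧-true : ∀ {x y} → x ≡ true → y ≡ true → x ∧ y ≡ true
∧-true refl refl = refl

-- Counting

bit : Bool → ℕ
bit t = if t then 1 else 0

card : (Fin n → Bool) → ℕ
card {zero}  p = 0
card {suc n} p = bit (p zero) + card (p ∘ suc)

_⊆_ : (p q : Fin n → Bool) → Set
p ⊆ q = ∀ x → p x ≡ true → q x ≡ true

sum-bit-tabulate : ∀ {A : Set} (p : A → Bool) (f : Fin n → A) →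
                   sum (map (bit ∘ p) (tabulate f)) ≡ card (p ∘ f)
sum-bit-tabulate {zero}  p f = refl
sum-bit-tabulate {suc n} p f = cong (bit (p (f zero)) +_) (sum-bit-tabulate p (f ∘ suc))

count≡card : (p : Fin n → Bool) → count p ≡ card p
count≡card p = sum-bit-tabulate p (λ x → x)

length-filter-tabulate : ∀ {A : Set} (p : A → Bool) (f : Fin n → A) →
                         length (filter (λ x → p x Bool.≟ true) (tabulate f)) ≡ card (p ∘ f)
length-filter-tabulate {zero}  p f = refl
length-filter-tabulate {suc n} p f with p (f zero)
... | true  = cong suc (length-filter-tabulate p (f ∘ suc))
... | false = length-filter-tabulate p (f ∘ suc)

length-filter≡card : (p : Fin n → Bool) → length (filter (λ x → p x Bool.≟ true) (allFin n)) ≡ card p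
length-filter≡card p = length-filter-tabulate p (λ x → x)

card-cong : {p q : Fin n → Bool} → (∀ x → p x ≡ q x) → card p ≡ card q
card-cong {zero}  eq = refl
card-cong {suc n} eq = cong₂ _+_ (cong bit (eq zero)) (card-cong (eq ∘ suc))

card-partition : {p q r : Fin n → Bool} → (∀ x → bit (p x) ≡ bit (q x) + bit (r x)) →
                 card p ≡ card q + card r
card-partition {zero}                  eq = refl
card-partition {suc n} {p} {q} {r} eq = begin
  bit (p zero) + card (p ∘ suc)
    ≡⟨ cong₂ _+_ (eq zero) (card-partition (eq ∘ suc)) ⟩
  (bit (q zero) + bit (r zero)) + (card (q ∘ suc) + card (r ∘ suc))
    ≡⟨ interchange (bit (q zero)) (bit (r zero)) (card (q ∘ suc)) (card (r ∘ suc)) ⟩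
  card q + card r
    ∎
  where open ≡-Reasoning

card-false : ∀ n → card {n} (λ _ → false) ≡ 0
card-false zero    = refl
card-false (suc n) = card-false n

card-true : ∀ n → card {n} (λ _ → true) ≡ n
card-true zero    = refl
card-true (suc n) = cong suc (card-true n)

bit-mono : ∀ {x y} → (x ≡ true → y ≡ true) → bit x ≤ bit y
bit-mono {false} _   = z≤n
bit-mono {true}  x⇒y rewrite x⇒y refl = ℕₚ.≤-refl

card-mono : {p q : Fin n → Bool} → p ⊆ q → card p ≤ card q
card-mono {zero}  p⊆q = z≤n
card-mono {suc n} p⊆q = ℕₚ.+-mono-≤ (bit-mono (p⊆q zero)) (card-mono (p⊆q ∘ suc))

card-mono-< : {p q : Fin n → Bool} → p ⊆ q → (y : Fin n) → p y ≡ false → q y ≡ true → card p < card q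
card-mono-< {suc n} p⊆q zero    py qy rewrite py | qy = s≤s (card-mono (p⊆q ∘ suc))
card-mono-< {suc n} p⊆q (suc y) py qy =
  ℕₚ.+-mono-≤-< (bit-mono (p⊆q zero)) (card-mono-< (p⊆q ∘ suc) y py qy)

_≡ᵇ_ : Fin n → Fin n → Bool
x ≡ᵇ y = does (x Finₚ.≟ y)

card-singleton : (y : Fin n) → card (_≡ᵇ y) ≡ 1
card-singleton {suc n} zero    = cong suc (card-false n)
card-singleton {suc n} (suc y) = trans (card-cong suc≡ᵇsuc) (card-singleton y)
  where
  suc≡ᵇsuc : ∀ x → (suc x ≡ᵇ suc y) ≡ (x ≡ᵇ y)
  suc≡ᵇsuc x with x Finₚ.≟ y
  ... | yes refl = refl
  ... | no _     = refl

card-remove : (p : Fin n → Bool) (y : Fin n) → p y ≡ true →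
              card p ≡ suc (card (λ x → p x ∧ not (x ≡ᵇ y)))
card-remove p y py =
  trans (card-partition split) (cong (_+ card (λ x → p x ∧ not (x ≡ᵇ y))) (card-singleton y))
  where
  split : ∀ x → bit (p x) ≡ bit (x ≡ᵇ y) + bit (p x ∧ not (x ≡ᵇ y))
  split x with x Finₚ.≟ y
  ... | yes refl rewrite py = refl
  ... | no _ with p x
  ...   | true  = refl
  ...   | false = refl

card-injection : (p : Fin n → Bool) (q : Fin m → Bool) (h : ∀ x → p x ≡ true → Fin m) →
                 (∀ x px → q (h x px) ≡ true) →
                 (∀ x y px py → h x px ≡ h y py → x ≡ y) →
                 card p ≤ card q
card-injection {zero}  p q h hq h-inj = z≤n
card-injection {suc n} p q h hq h-inj with p zero in p0
... | false = card-injection (p ∘ suc) q (h ∘ suc) (hq ∘ suc)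
                (λ x y px py e → Finₚ.suc-injective (h-inj (suc x) (suc y) px py e))
... | true  = ℕₚ.≤-trans (s≤s rest) (ℕₚ.≤-reflexive (sym (card-remove q y (hq zero p0))))
  where
  y = h zero p0
  avoids-y : ∀ x px → (h (suc x) px ≡ᵇ y) ≡ false
  avoids-y x px = dec-false (h (suc x) px Finₚ.≟ y) (λ e → Finₚ.0≢1+n (sym (h-inj (suc x) zero px p0 e)))
  rest : card (p ∘ suc) ≤ card (λ z → q z ∧ not (z ≡ᵇ y))
  rest = card-injection (p ∘ suc) _ (h ∘ suc)
           (λ x px → ∧-true (hq (suc x) px) (cong not (avoids-y x px)))
           (λ x x' px px' e → Finₚ.suc-injective (h-inj (suc x) (suc x') px px' e))

-- Ballot words

Ballot : ℕ → ℕ → List Letter → Set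
Ballot c d u = ∀ m → d + countB (take m u) ≤ c + countA (take m u)

ballot⇒≤ : ∀ {c d u} → Ballot c d u → d ≤ c
ballot⇒≤ {c} {d} h = subst₂ _≤_ (ℕₚ.+-identityʳ d) (ℕₚ.+-identityʳ c) (h 0)

ballot-[] : ∀ {c d} → d ≤ c → Ballot c d []
ballot-[] d≤c zero    = ℕₚ.+-monoˡ-≤ 0 d≤c
ballot-[] d≤c (suc m) = ℕₚ.+-monoˡ-≤ 0 d≤c

ballot-a∷ : ∀ {c d u} → Ballot c d (a ∷ u) ⇔ (d ≤ c × Ballot (suc c) d u)
ballot-a∷ {c} {d} {u} = mk⇔
  (λ h → ballot⇒≤ h , λ m → subst (d + countB (take m u) ≤_) (ℕₚ.+-suc c _) (h (suc m)))
  (λ { (d≤c , h) zero    → ℕₚ.+-monoˡ-≤ 0 d≤c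
     ; (d≤c , h) (suc m) → subst (d + countB (take m u) ≤_) (sym (ℕₚ.+-suc c _)) (h m) })

ballot-b∷ : ∀ {c d u} → Ballot c d (b ∷ u) ⇔ (d ≤ c × Ballot c (suc d) u)
ballot-b∷ {c} {d} {u} = mk⇔
  (λ h → ballot⇒≤ h , λ m → subst (_≤ c + countA (take m u)) (ℕₚ.+-suc d _) (h (suc m)))
  (λ { (d≤c , h) zero    → ℕₚ.+-monoˡ-≤ 0 d≤c
     ; (d≤c , h) (suc m) → subst (_≤ c + countA (take m u)) (sym (ℕₚ.+-suc d _)) (h m) })

ballot-as : ∀ x {c d u} → Ballot c d (replicate x a ++ u) ⇔ (d ≤ c × Ballot (x + c) d u)
ballot-as zero            = mk⇔ (λ h → ballot⇒≤ h , h) proj₂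
ballot-as (suc x) {c} {d} {u} = mk⇔
  (λ h → let d≤c , h′ = to ballot-a∷ h in
         d≤c , subst (λ c′ → Ballot c′ d u) (ℕₚ.+-suc x c) (proj₂ (to (ballot-as x) h′)))
  (λ (d≤c , h) → from ballot-a∷
     (d≤c , from (ballot-as x)
              (ℕₚ.m≤n⇒m≤1+n d≤c , subst (λ c′ → Ballot c′ d u) (sym (ℕₚ.+-suc x c)) h)))

ballot-bs : ∀ y {c d u} → Ballot c d (replicate y b ++ u) ⇔ Ballot c (y + d) u
ballot-bs zero            = mk⇔ (λ h → h) (λ h → h)
ballot-bs (suc y) {c} {d} {u} = mk⇔
  (λ h → subst (λ d′ → Ballot c d′ u) (ℕₚ.+-suc y d) (to (ballot-bs y) (proj₂ (to ballot-b∷ h))))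
  (λ h → from ballot-b∷
     ( ℕₚ.≤-trans (ℕₚ.m≤n+m d (suc y)) (ballot⇒≤ h)
     , from (ballot-bs y) (subst (λ d′ → Ballot c d′ u) (sym (ℕₚ.+-suc y d)) h)))

countA-as : ∀ x u → countA (replicate x a ++ u) ≡ x + countA u
countA-as zero    u = refl
countA-as (suc x) u = cong suc (countA-as x u)

countA-bs : ∀ y u → countA (replicate y b ++ u) ≡ countA u
countA-bs zero    u = refl
countA-bs (suc y) u = countA-bs y u

countB-as : ∀ x u → countB (replicate x a ++ u) ≡ countB u
countB-as zero    u = refl
countB-as (suc x) u = countB-as x u

countB-bs : ∀ y u → countB (replicate y b ++ u) ≡ y + countB u
countB-bs zero    u = refl
countB-bs (suc y) u = cong suc (countB-bs y u)

blocks : (ℕ → ℕ) → (ℕ → ℕ) → ℕ → List Letter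
blocks x y zero    = []
blocks x y (suc t) = replicate (x t) a ++ replicate (y t) b ++ blocks x y t

module BlockWord (x y A B : ℕ → ℕ)
         (A-step : ∀ s → A s ≡ x s + A (suc s))
         (B-step : ∀ s → B s ≡ y s + B (suc s)) where

  ballot-blocks : ∀ t → Ballot (A t) (B t) (blocks x y t) ⇔ (∀ s → s ≤ t → B s ≤ A s)
  ballot-blocks zero    = mk⇔ (λ { h .0 z≤n → ballot⇒≤ h }) (λ h → ballot-[] (h 0 z≤n))
  ballot-blocks (suc t) = mk⇔ forward backward
    where
    forward : Ballot (A (suc t)) (B (suc t)) (blocks x y (suc t)) → ∀ s → s ≤ suc t → B s ≤ A s
    forward h s s≤1+t with to (ballot-as (x t)) h
    ... | top , h′ with ℕₚ.m≤n⇒m<n∨m≡n s≤1+t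
    ...   | inj₂ refl   = top
    ...   | inj₁ s<1+t  = to (ballot-blocks t)
                            (subst₂ (λ c d → Ballot c d (blocks x y t)) (sym (A-step t)) (sym (B-step t))
                                    (to (ballot-bs (y t)) h′))
                            s (ℕₚ.≤-pred s<1+t)
    backward : (∀ s → s ≤ suc t → B s ≤ A s) → Ballot (A (suc t)) (B (suc t)) (blocks x y (suc t))
    backward h = from (ballot-as (x t))
      ( h (suc t) ℕₚ.≤-refl
      , from (ballot-bs (y t))
          (subst₂ (λ c d → Ballot c d (blocks x y t)) (A-step t) (B-step t)
                  (from (ballot-blocks t) (λ s s≤t → h s (ℕₚ.m≤n⇒m≤1+n s≤t)))))

  countA-blocks : ∀ t → countA (blocks x y t) + A t ≡ A 0
  countA-blocks zero    = refl
  countA-blocks (suc t) = begin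
    countA (blocks x y (suc t)) + A (suc t)
      ≡⟨ cong (_+ A (suc t)) (trans (countA-as (x t) _) (cong (x t +_) (countA-bs (y t) _))) ⟩
    x t + countA (blocks x y t) + A (suc t)
      ≡⟨ xy∙z≈y∙xz (x t) _ _ ⟩
    countA (blocks x y t) + (x t + A (suc t))
      ≡⟨ cong (countA (blocks x y t) +_) (sym (A-step t)) ⟩
    countA (blocks x y t) + A t
      ≡⟨ countA-blocks t ⟩
    A 0
      ∎
    where open ≡-Reasoning

  countB-blocks : ∀ t → countB (blocks x y t) + B t ≡ B 0
  countB-blocks zero    = refl
  countB-blocks (suc t) = begin
    countB (blocks x y (suc t)) + B (suc t)
      ≡⟨ cong (_+ B (suc t)) (trans (countB-as (x t) _) (countB-bs (y t) _)) ⟩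
    y t + countB (blocks x y t) + B (suc t)
      ≡⟨ xy∙z≈y∙xz (y t) _ _ ⟩
    countB (blocks x y t) + (y t + B (suc t))
      ≡⟨ cong (countB (blocks x y t) +_) (sym (B-step t)) ⟩
    countB (blocks x y t) + B t
      ≡⟨ countB-blocks t ⟩
    B 0
      ∎
    where open ≡-Reasoning

map-proj₂-tag : ∀ {X : Set} (xs : List X) (l : Letter) →
                map proj₂ (map (_, l) xs) ≡ replicate (length xs) l
map-proj₂-tag []       l = refl
map-proj₂-tag (_ ∷ xs) l = cong (l ∷_) (map-proj₂-tag xs l)

tagged-blocks : ∀ {X : Set} (xs ys : ℕ → List X) t →
  map proj₂ (concatMap (λ s → map (_, a) (xs s) ++ map (_, b) (ys s)) (downFrom t))
    ≡ blocks (length ∘ xs) (length ∘ ys) t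
tagged-blocks xs ys zero    = refl
tagged-blocks xs ys (suc t) = begin
  map proj₂ ((tagA ++ tagB) ++ rest)  ≡⟨ cong (map proj₂) (Listₚ.++-assoc tagA tagB rest) ⟩
  map proj₂ (tagA ++ tagB ++ rest)    ≡⟨ Listₚ.map-++ proj₂ tagA (tagB ++ rest) ⟩
  map proj₂ tagA ++ map proj₂ (tagB ++ rest)
    ≡⟨ cong₂ _++_ (map-proj₂-tag (xs t) a)
                  (trans (Listₚ.map-++ proj₂ tagB rest)
                         (cong₂ _++_ (map-proj₂-tag (ys t) b) (tagged-blocks xs ys t))) ⟩
  blocks (length ∘ xs) (length ∘ ys) (suc t) ∎
  where
  open ≡-Reasoning
  tagA = map (_, a) (xs t)
  tagB = map (_, b) (ys t)
  rest = concatMap (λ s → map (_, a) (xs s) ++ map (_, b) (ys s)) (downFrom t)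

-- Travel times

ℕ→ℚ-suc : ∀ k → ℕ→ℚ (suc k) ≡ 1ℚ ℚ.+ ℕ→ℚ k
ℕ→ℚ-suc k = ℚₚ.toℚᵘ-injective (begin
  toℚᵘ (ℕ→ℚ (suc k))                ≈⟨ ℚₚ.toℚᵘ-fromℚᵘ (mkℚᵘ (ℤ.+ suc k) 0) ⟩
  mkℚᵘ (ℤ.+ suc k) 0                 ≈⟨ *≡* (trans (ℤₚ.*-identityʳ _) (sym (trans (ℤₚ.*-identityʳ _)
                                           (cong (ℤ._+_ (ℤ.+ 1)) (ℤₚ.*-identityʳ (ℤ.+ k)))))) ⟩
  toℚᵘ 1ℚ ℚᵘ.+ mkℚᵘ (ℤ.+ k) 0        ≈⟨ ℚᵘₚ.+-congʳ (toℚᵘ 1ℚ) (ℚₚ.toℚᵘ-fromℚᵘ (mkℚᵘ (ℤ.+ k) 0)) ⟨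
  toℚᵘ 1ℚ ℚᵘ.+ toℚᵘ (ℕ→ℚ k)          ≈⟨ ℚₚ.toℚᵘ-homo-+ 1ℚ (ℕ→ℚ k) ⟨
  toℚᵘ (1ℚ ℚ.+ ℕ→ℚ k)                ∎)
  where open ℚᵘₚ.≃-Reasoning

module _ (w v : ℚ) .{{_ : Positive w}} .{{_ : Positive v}} where

  private instance
    w≢0 : NonZero w
    w≢0 = ℚₚ.pos⇒nonZero w
    v≢0 : NonZero v
    v≢0 = ℚₚ.pos⇒nonZero v

  -- arrival w v M i j unfolds to travelTime w v j (S M i j).
  travelTime : ℕ → ℕ → ℚ
  travelTime j s = ℕ→ℚ (j ∸ s) ℚ.÷ w ℚ.+ ℕ→ℚ s ℚ.÷ v

  module _ (w<v : w ℚ.< v) where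
    private
      1/v<1/w : 1/ v ℚ.< 1/ w
      1/v<1/w = subst₂ ℚ._<_ (cancel w (1/ v))
                  (trans (cong (v ℚ.*_) (ℚₚ.*-comm (1/ w) (1/ v))) (cancel v (1/ w)))
                  (ℚₚ.*-monoˡ-<-pos (1/ w ℚ.* 1/ v) {{1/w*1/v>0}} w<v)
        where
        1/w*1/v>0 : Positive (1/ w ℚ.* 1/ v)
        1/w*1/v>0 = ℚₚ.pos*pos⇒pos (1/ w) {{ℚₚ.1/pos⇒pos w}} (1/ v) {{ℚₚ.1/pos⇒pos v}}
        cancel : ∀ p .{{_ : NonZero p}} q → p ℚ.* (1/ p ℚ.* q) ≡ q
        cancel p q = trans (sym (ℚₚ.*-assoc p (1/ p) q))
                           (trans (cong (ℚ._* q) (ℚₚ.*-inverseʳ p)) (ℚₚ.*-identityˡ q))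

    travelTime-step : ∀ {j s} → suc s ≤ j → travelTime j (suc s) ℚ.< travelTime j s
    travelTime-step {j} {s} s<j = subst₂ ℚ._<_ (sym cycled) (sym walked) (ℚₚ.+-monoˡ-< rest 1/v<1/w)
      where
      open +-*-Solver
      walk = ℕ→ℚ (j ∸ suc s)
      ride = ℕ→ℚ s
      rest = walk ℚ.* 1/ w ℚ.+ ride ℚ.* 1/ v
      cycled : travelTime j (suc s) ≡ 1/ v ℚ.+ rest
      cycled = trans (cong (λ r → walk ℚ.* 1/ w ℚ.+ r ℚ.* 1/ v) (ℕ→ℚ-suc s))
        (solve 4 (λ p q x y → p :* x :+ (con 1ℚ :+ q) :* y := y :+ (p :* x :+ q :* y))
                 refl walk ride (1/ w) (1/ v))
      walked : travelTime j s ≡ 1/ w ℚ.+ rest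
      walked = trans (cong (λ r → ℕ→ℚ r ℚ.* 1/ w ℚ.+ ride ℚ.* 1/ v) (ℕₚ.+-∸-assoc 1 s<j))
        (trans (cong (λ r → r ℚ.* 1/ w ℚ.+ ride ℚ.* 1/ v) (ℕ→ℚ-suc (j ∸ suc s)))
          (solve 4 (λ p q x y → (con 1ℚ :+ p) :* x :+ q :* y := x :+ (p :* x :+ q :* y))
                   refl walk ride (1/ w) (1/ v)))

    travelTime-strict : ∀ {j s s′} → s < s′ → s′ ≤ j → travelTime j s′ ℚ.< travelTime j s
    travelTime-strict {j} {s} {suc s′} (s≤s s≤s′) s′<j with ℕₚ.m≤n⇒m<n∨m≡n s≤s′
    ... | inj₂ refl = travelTime-step s′<j
    ... | inj₁ s<s′ = ℚₚ.<-trans (travelTime-step s′<j) (travelTime-strict s<s′ (ℕₚ.<⇒≤ s′<j))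

    travelTime-antitone : ∀ {j s s′} → s ≤ s′ → s′ ≤ j → travelTime j s′ ℚ.≤ travelTime j s
    travelTime-antitone s≤s′ s′≤j with ℕₚ.m≤n⇒m<n∨m≡n s≤s′
    ... | inj₂ refl = ℚₚ.≤-refl
    ... | inj₁ s<s′ = ℚₚ.<⇒≤ (travelTime-strict s<s′ s′≤j)

    travelTime-reflects : ∀ {j s s′} → s ≤ j → travelTime j s′ ℚ.≤ travelTime j s → s ≤ s′
    travelTime-reflects {s = s} {s′} s≤j t′≤t with ℕₚ.≤-<-connex s s′
    ... | inj₁ s≤s′ = s≤s′
    ... | inj₂ s′<s = ⊥-elim (ℚₚ.<-irrefl refl (ℚₚ.<-≤-trans (travelTime-strict s′<s s≤j) t′≤t))

-- Riders of a stage

entry-fromℕ< : (M : Matrix n) (i : Fin n) {j : ℕ} (j<n : j < n) → entry M i (suc j) ≡ M i (fromℕ< j<n)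
entry-fromℕ< {n} M i {j} j<n with j ℕ.<? n
... | yes j<n′ = cong (M i) (Finₚ.fromℕ<-cong j j refl j<n′ j<n)
... | no  j≮n  = ⊥-elim (j≮n j<n)

entry-bounds : (M : Matrix n) (i : Fin n) (j : ℕ) → entry M i j ≡ true → 1 ≤ j × j ≤ n
entry-bounds M i zero ()
entry-bounds {n} M i (suc j) e with j ℕ.<? n
... | yes j<n = s≤s z≤n , j<n

S-bound : (M : Matrix n) (i : Fin n) (j : ℕ) → S M i j ≤ j
S-bound M i zero    = z≤n
S-bound M i (suc j) = subst (S M i (suc j) ≤_) (ℕₚ.+-comm j 1)
                        (ℕₚ.+-mono-≤ (S-bound M i j) (bit-mono {y = true} (λ _ → refl)))

S-step : (M : Matrix n) (i : Fin n) (j : ℕ) → entry M i (suc j) ≡ true → S M i (suc j) ≡ S M i j + 1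
S-step M i j e = cong (λ t → S M i j + bit t) e

bit-level : ∀ t s m → bit (t ∧ does (s ≤? m)) ≡ bit (t ∧ ⌊ m ≟ s ⌋) + bit (t ∧ does (suc s ≤? m))
bit-level false s m = refl
bit-level true  s m with m ≟ s
... | yes refl rewrite dec-true (m ≤? m) ℕₚ.≤-refl | dec-false (suc m ≤? m) (ℕₚ.n≮n m) = refl
... | no m≢s with s ≤? m
...   | yes s≤m rewrite dec-true (s ≤? m) s≤m | dec-true (suc s ≤? m) (ℕₚ.≤∧≢⇒< s≤m (m≢s ∘ sym)) = refl
...   | no  s≰m rewrite dec-false (s ≤? m) s≰m | dec-false (suc s ≤? m) (s≰m ∘ ℕₚ.<⇒≤) = refl

bit-leaving : ∀ x y z → bit (x ∧ z) ≡ bit ((x ∧ y) ∧ z) + bit ((x ∧ not y) ∧ z)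
bit-leaving false y     z = refl
bit-leaving true  true  z = sym (ℕₚ.+-identityʳ (bit z))
bit-leaving true  false z = refl

bit-joining : ∀ x y z → bit (y ∧ z) ≡ bit ((x ∧ y) ∧ z) + bit ((not x ∧ y) ∧ z)
bit-joining true  y     z = sym (ℕₚ.+-identityʳ (bit (y ∧ z)))
bit-joining false y     z = refl

module _ (M : Matrix n) where

  rides : ℕ → Fin n → Bool
  rides j i = entry M i j

  above : ℕ → ℕ → Fin n → Bool
  above j s i = does (s ≤? S M i j)

  cardAbove : ℕ → ℕ → (Fin n → Bool) → ℕ
  cardAbove j s p = card (λ i → p i ∧ above j s i)

  leaving joining : ℕ → ℕ → ℕ
  leaving j s = cardAbove j s (inX10 M j)
  joining j s = cardAbove j s (inX01 M j)

  HallCondition : ℕ → Set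
  HallCondition j = ∀ s → s ≤ suc j → cardAbove j s (rides (suc j)) ≤ cardAbove j s (rides j)

  cardAbove-zero : ∀ j p → cardAbove j 0 p ≡ card p
  cardAbove-zero j p = card-cong (λ i → ∧-identityʳ (p i))

  cardAbove-beyond : ∀ j p → cardAbove j (suc j) p ≡ 0
  cardAbove-beyond j p = trans (card-cong none) (card-false n)
    where
    none : ∀ i → p i ∧ above j (suc j) i ≡ false
    none i = trans (cong (p i ∧_) (dec-false (suc j ≤? S M i j) (ℕₚ.<⇒≱ (s≤s (S-bound M i j)))))
                   (∧-zeroʳ (p i))

  atLevel : ℕ → ℕ → (Fin n → Bool) → List (Fin n)
  atLevel j s p = filter (λ i → (p i ∧ ⌊ S M i j ≟ s ⌋) Bool.≟ true) (allFin n)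

  cardAbove-level : ∀ j s p → cardAbove j s p ≡ length (atLevel j s p) + cardAbove j (suc s) p
  cardAbove-level j s p =
    trans (card-partition (λ i → bit-level (p i) s (S M i j)))
          (cong (_+ cardAbove j (suc s) p) (sym (length-filter≡card (λ i → p i ∧ ⌊ S M i j ≟ s ⌋))))

  private
    staying : ℕ → Fin n → Bool
    staying j i = rides j i ∧ rides (suc j) i

    leavingAt joiningAt : ℕ → ℕ → ℕ
    leavingAt j s = length (atLevel j s (inX10 M j))
    joiningAt j s = length (atLevel j s (inX01 M j))

    word : ℕ → List Letter
    word j = blocks (leavingAt j) (joiningAt j) (suc j)

    module Word (j : ℕ) = BlockWord (leavingAt j) (joiningAt j) (leaving j) (joining j)
      (λ s → cardAbove-level j s (inX10 M j)) (λ s → cardAbove-level j s (inX01 M j))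

  canonicalWord≡blocks : ∀ j → canonicalWord M j ≡ word j
  canonicalWord≡blocks j =
    tagged-blocks (λ s → atLevel j s (inX10 M j)) (λ s → atLevel j s (inX01 M j)) (suc j)

  cardAbove-leaving : ∀ j s → cardAbove j s (rides j) ≡ cardAbove j s (staying j) + leaving j s
  cardAbove-leaving j s = card-partition (λ i → bit-leaving (rides j i) (rides (suc j) i) (above j s i))

  cardAbove-joining : ∀ j s → cardAbove j s (rides (suc j)) ≡ cardAbove j s (staying j) + joining j s
  cardAbove-joining j s = card-partition (λ i → bit-joining (rides j i) (rides (suc j) i) (above j s i))

  joining≤leaving⇔hall : ∀ j s → joining j s ≤ leaving j s ⇔
                                   cardAbove j s (rides (suc j)) ≤ cardAbove j s (rides j)
  joining≤leaving⇔hall j s = mk⇔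
    (λ le → subst₂ _≤_ (sym (cardAbove-joining j s)) (sym (cardAbove-leaving j s))
                      (ℕₚ.+-monoʳ-≤ (cardAbove j s (staying j)) le))
    (λ le → ℕₚ.+-cancelˡ-≤ (cardAbove j s (staying j)) _ _
              (subst₂ _≤_ (cardAbove-joining j s) (cardAbove-leaving j s) le))

  ballot⇔hall : ∀ j → Ballot 0 0 (canonicalWord M j) ⇔ HallCondition j
  ballot⇔hall j = mk⇔
    (λ h s s≤1+j → to (joining≤leaving⇔hall j s) (to (Word.ballot-blocks j (suc j)) (fromTop h) s s≤1+j))
    (λ h → toTop (from (Word.ballot-blocks j (suc j))
                         (λ s s≤1+j → from (joining≤leaving⇔hall j s) (h s s≤1+j))))
    where
    ballot-cong : ∀ {c c′ d d′ u u′} → c ≡ c′ → d ≡ d′ → u ≡ u′ → Ballot c d u → Ballot c′ d′ u′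
    ballot-cong refl refl refl h = h
    fromTop : Ballot 0 0 (canonicalWord M j) → Ballot (leaving j (suc j)) (joining j (suc j)) (word j)
    fromTop = ballot-cong (sym (cardAbove-beyond j (inX10 M j))) (sym (cardAbove-beyond j (inX01 M j)))
                          (canonicalWord≡blocks j)
    toTop : Ballot (leaving j (suc j)) (joining j (suc j)) (word j) → Ballot 0 0 (canonicalWord M j)
    toTop = ballot-cong (cardAbove-beyond j (inX10 M j)) (cardAbove-beyond j (inX01 M j))
                        (sym (canonicalWord≡blocks j))

  countA-canonicalWord : ∀ j → countA (canonicalWord M j) ≡ leaving j 0
  countA-canonicalWord j = begin
    countA (canonicalWord M j)                        ≡⟨ cong countA (canonicalWord≡blocks j) ⟩
    countA (word j)                      ≡⟨ sym (ℕₚ.+-identityʳ _) ⟩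
    countA (word j) + 0                  ≡⟨ cong (countA (word j) +_) (sym (cardAbove-beyond j (inX10 M j))) ⟩
    countA (word j) + leaving j (suc j)  ≡⟨ Word.countA-blocks j (suc j) ⟩
    leaving j 0                                       ∎
    where open ≡-Reasoning

  countB-canonicalWord : ∀ j → countB (canonicalWord M j) ≡ joining j 0
  countB-canonicalWord j = begin
    countB (canonicalWord M j)                        ≡⟨ cong countB (canonicalWord≡blocks j) ⟩
    countB (word j)                      ≡⟨ sym (ℕₚ.+-identityʳ _) ⟩
    countB (word j) + 0                  ≡⟨ cong (countB (word j) +_) (sym (cardAbove-beyond j (inX01 M j))) ⟩
    countB (word j) + joining j (suc j)  ≡⟨ Word.countB-blocks j (suc j) ⟩
    joining j 0                                       ∎
    where open ≡-Reasoning

  card-rides : ∀ {k} → Uniform k M → ∀ {j} → 1 ≤ j → j ≤ n → card (rides j) ≡ k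
  card-rides (_ , columns) {suc j} _ j<n =
    trans (card-cong (λ i → entry-fromℕ< M i j<n))
          (trans (sym (count≡card (λ i → M i (fromℕ< j<n)))) (columns (fromℕ< j<n)))

  leaving≡joining : ∀ {k} → Uniform k M → ∀ {j} → 1 ≤ j → suc j ≤ n → leaving j 0 ≡ joining j 0
  leaving≡joining U {j} 1≤j 1+j≤n = ℕₚ.+-cancelˡ-≡ (cardAbove j 0 (staying j)) _ _ (begin
    cardAbove j 0 (staying j) + leaving j 0 ≡⟨ sym (cardAbove-leaving j 0) ⟩
    cardAbove j 0 (rides j)                 ≡⟨ cardAbove-zero j (rides j) ⟩
    card (rides j)                          ≡⟨ card-rides U 1≤j (ℕₚ.<⇒≤ 1+j≤n) ⟩
    _                                       ≡⟨ sym (card-rides U (s≤s z≤n) 1+j≤n) ⟩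
    card (rides (suc j))                    ≡⟨ sym (cardAbove-zero j (rides (suc j))) ⟩
    cardAbove j 0 (rides (suc j))           ≡⟨ cardAbove-joining j 0 ⟩
    cardAbove j 0 (staying j) + joining j 0 ∎)
    where open ≡-Reasoning

  dyck⇔hall : ∀ {k} → Uniform k M → ∀ {j} → 1 ≤ j → suc j ≤ n →
              Dyck (canonicalWord M j) ⇔ HallCondition j
  dyck⇔hall U {j} 1≤j 1+j≤n = mk⇔
    (λ (_ , ballot) → to (ballot⇔hall j) ballot)
    (λ hall → trans (countA-canonicalWord j)
                    (trans (leaving≡joining U 1≤j 1+j≤n) (sym (countB-canonicalWord j)))
            , from (ballot⇔hall j) hall)

-- Ranks in a strict total order

module Ranking {_≺_ : Rel (Fin n) 0ℓ} (≺-sto : IsStrictTotalOrder _≡_ _≺_) (p : Fin n → Bool) where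

  open IsStrictTotalOrder ≺-sto using (_<?_; compare; irrefl) renaming (trans to ≺-trans)

  rank : Fin n → ℕ
  rank y = card (λ x → p x ∧ does (x <? y))

  private
    not-below-self : ∀ x → p x ∧ does (x <? x) ≡ false
    not-below-self x = trans (cong (p x ∧_) (dec-false (x <? x) (irrefl refl))) (∧-zeroʳ (p x))

  card-below≤rank : ∀ {q : Fin n → Bool} y → (∀ z → p z ≡ true → q z ≡ true → z ≺ y) →
                    card (λ z → p z ∧ q z) ≤ rank y
  card-below≤rank {q} y below = card-mono {p = λ z → p z ∧ q z} λ z h →
    let pz , qz = ∧-true⁻ h in ∧-true pz (dec-true (z <? y) (below z pz qz))

  rank<card-downClosed : ∀ {q : Fin n → Bool} x → p x ≡ true → q x ≡ true →
                         (∀ z → p z ≡ true → z ≺ x → q z ≡ true) → rank x < card (λ z → p z ∧ q z)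
  rank<card-downClosed {q} x px qx closed = card-mono-< {q = λ z → p z ∧ q z}
    (λ z h → let pz , z≺x = ∧-true⁻ h in ∧-true pz (closed z pz (does-true (z <? x) z≺x)))
    x (not-below-self x) (∧-true px qx)

  rank-mono : ∀ {x y} → p x ≡ true → x ≺ y → rank x < rank y
  rank-mono {x} {y} px x≺y = ℕₚ.<-≤-trans
    (rank<card-downClosed x px (dec-true (x <? y) x≺y)
                          (λ z _ z≺x → dec-true (z <? y) (≺-trans z≺x x≺y)))
    (card-below≤rank y (λ z _ z≺y → does-true (z <? y) z≺y))

  rank-injective : ∀ {x y} → p x ≡ true → p y ≡ true → rank x ≡ rank y → x ≡ y
  rank-injective {x} {y} px py eq with compare x y
  ... | tri< x≺y _ _ = ⊥-elim (ℕₚ.<-irrefl eq (rank-mono px x≺y))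
  ... | tri≈ _ x≡y _ = x≡y
  ... | tri> _ _ y≺x = ⊥-elim (ℕₚ.<-irrefl (sym eq) (rank-mono py y≺x))

  rank<card : ∀ {x} → p x ≡ true → rank x < card p
  rank<card {x} px = card-mono-< {q = p} (λ z h → proj₁ (∧-true⁻ h)) x (not-below-self x) px

  rank-surjective : ∀ {r} → r < card p → ∃ λ x → p x ≡ true × rank x ≡ r
  rank-surjective {r} r<card with Finₚ.any? (λ x → (p x Bool.≟ true) ×-dec (rank x ≟ r))
  ... | yes hit = hit
  ... | no miss = ⊥-elim (ℕₚ.<-irrefl refl (begin-strict
    card p                                ≤⟨ card-injection p others toFin avoids-r toFin-injective ⟩
    card others                           <⟨ ℕₚ.n<1+n (card others) ⟩
    suc (card others)                     ≡⟨ sym (card-remove (λ _ → true) r′ refl) ⟩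
    card {card p} (λ _ → true)            ≡⟨ card-true (card p) ⟩
    card p                                ∎))
    where
    open ℕₚ.≤-Reasoning
    r′ = fromℕ< r<card
    others : Fin (card p) → Bool
    others q = not (q ≡ᵇ r′)
    toFin : ∀ x → p x ≡ true → Fin (card p)
    toFin x px = fromℕ< (rank<card px)
    avoids-r : ∀ x px → others (toFin x px) ≡ true
    avoids-r x px = cong not (dec-false (toFin x px Finₚ.≟ r′)
      (λ e → miss (x , px , Finₚ.fromℕ<-injective _ _ (rank<card px) r<card e)))
    toFin-injective : ∀ x y px py → toFin x px ≡ toFin y py → x ≡ y
    toFin-injective x y px py e =
      rank-injective px py (Finₚ.fromℕ<-injective _ _ (rank<card px) (rank<card py) e)

-- Serving the riders of a post in order of arrival

module _ (M : Matrix n) where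

  -- The riders at P_j in order of arrival: more stages cycled means earlier arrival; ties are
  -- broken by index.
  _≺[_]_ : Fin n → ℕ → Fin n → Set
  x ≺[ j ] y = S M y j < S M x j ⊎ (S M x j ≡ S M y j × x Fin.< y)

  ≺-isStrictTotalOrder : ∀ j → IsStrictTotalOrder _≡_ (_≺[ j ]_)
  ≺-isStrictTotalOrder j = record
    { isStrictPartialOrder = record
      { isEquivalence = isEquivalence
      ; irrefl        = λ { refl → ≺-irrefl }
      ; trans         = ≺-trans
      ; <-resp-≈      = resp₂ (_≺[ j ]_)
      }
    ; compare = ≺-compare
    }
    where
    ≺-irrefl : ∀ {x} → ¬ x ≺[ j ] x
    ≺-irrefl (inj₁ lt)       = ℕₚ.<-irrefl refl lt
    ≺-irrefl (inj₂ (_ , lt)) = ℕₚ.<-irrefl refl lt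

    ≺-trans : ∀ {x y z} → x ≺[ j ] y → y ≺[ j ] z → x ≺[ j ] z
    ≺-trans (inj₁ p)       (inj₁ q)        = inj₁ (ℕₚ.<-trans q p)
    ≺-trans (inj₁ p)       (inj₂ (e , _))  = inj₁ (subst (_< _) e p)
    ≺-trans (inj₂ (e , _)) (inj₁ q)        = inj₁ (subst (_ <_) (sym e) q)
    ≺-trans (inj₂ (e , p)) (inj₂ (e′ , q)) = inj₂ (trans e e′ , ℕₚ.<-trans p q)

    ≺⇒tri< : ∀ {x y} → x ≺[ j ] y → Tri (x ≺[ j ] y) (x ≡ y) (y ≺[ j ] x)
    ≺⇒tri< x≺y = tri< x≺y (λ { refl → ≺-irrefl x≺y }) (λ y≺x → ≺-irrefl (≺-trans x≺y y≺x))

    ≻⇒tri> : ∀ {x y} → y ≺[ j ] x → Tri (x ≺[ j ] y) (x ≡ y) (y ≺[ j ] x)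
    ≻⇒tri> y≺x = tri> (λ x≺y → ≺-irrefl (≺-trans x≺y y≺x)) (λ { refl → ≺-irrefl y≺x }) y≺x

    ≺-compare : ∀ x y → Tri (x ≺[ j ] y) (x ≡ y) (y ≺[ j ] x)
    ≺-compare x y with ℕₚ.<-cmp (S M x j) (S M y j)
    ... | tri< lt _ _ = ≻⇒tri> (inj₁ lt)
    ... | tri> _ _ gt = ≺⇒tri< (inj₁ gt)
    ... | tri≈ _ eq _ with Finₚ.<-cmp x y
    ...   | tri< lt _ _   = ≺⇒tri< (inj₂ (eq , lt))
    ...   | tri≈ _ refl _ = tri≈ ≺-irrefl refl ≺-irrefl
    ...   | tri> _ _ gt   = ≻⇒tri> (inj₂ (sym eq , gt))

  module StageRanking (j : ℕ) = Ranking (≺-isStrictTotalOrder j) (rides M j)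
  open StageRanking using (rank)

  ≺⇒S≥ : ∀ {j x y} → x ≺[ j ] y → S M y j ≤ S M x j
  ≺⇒S≥ (inj₁ lt)       = ℕₚ.<⇒≤ lt
  ≺⇒S≥ (inj₂ (eq , _)) = ℕₚ.≤-reflexive (sym eq)

  cardAbove≤rank : ∀ {j s} y → S M y j < s → cardAbove M j s (rides M j) ≤ rank j y
  cardAbove≤rank {j} {s} y Sy<s = StageRanking.card-below≤rank j y
    (λ z _ s≤Sz → inj₁ (ℕₚ.<-≤-trans Sy<s (does-true (s ≤? S M z j) s≤Sz)))

  rank<cardAbove : ∀ {j i} → rides M (suc j) i ≡ true →
                   rank (suc j) i < cardAbove M j (S M i j) (rides M (suc j))
  rank<cardAbove {j} {i} ri = StageRanking.rank<card-downClosed (suc j) {q = above M j (S M i j)} i ri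
    (dec-true (S M i j ≤? S M i j) ℕₚ.≤-refl)
    (λ z rz z≺i → dec-true (S M i j ≤? S M z j)
       (ℕₚ.+-cancelʳ-≤ 1 _ _ (subst₂ _≤_ (S-step M i j ri) (S-step M z j rz) (≺⇒S≥ z≺i))))

  hall⇒same-rank⇒S≤ : ∀ {j i i′} → HallCondition M j → rides M (suc j) i ≡ true →
                   rank j i′ ≡ rank (suc j) i → S M i j ≤ S M i′ j
  hall⇒same-rank⇒S≤ {j} {i} {i′} hall ri eq with ℕₚ.≤-<-connex (S M i j) (S M i′ j)
  ... | inj₁ S≤S′ = S≤S′
  ... | inj₂ S′<S = ⊥-elim (ℕₚ.<-irrefl (sym eq) (begin-strict
    rank (suc j) i                            <⟨ rank<cardAbove ri ⟩
    cardAbove M j (S M i j) (rides M (suc j)) ≤⟨ hall (S M i j) (ℕₚ.m≤n⇒m≤1+n (S-bound M i j)) ⟩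
    cardAbove M j (S M i j) (rides M j)       ≤⟨ cardAbove≤rank {j} i′ S′<S ⟩
    rank j i′                                 ∎))
    where open ℕₚ.≤-Reasoning

-- Executions

module _ (w v : ℚ) .{{_ : Positive w}} .{{_ : Positive v}} (w<v : w ℚ.< v) (M : Matrix n) where

  open Execution
  open StageRanking M using (rank)

  execution⇒hall : ∀ {k j} → Execution w v M k → 1 ≤ j → HallCondition M j
  execution⇒hall {k} {j} ex 1≤j s _ = card-injection _ _ bringer brings-above bringer-injective
    where
    bringer : ∀ i → rides M (suc j) i ∧ above M j s i ≡ true → Fin n
    bringer i h = proj₁ (available ex i j (proj₁ (∧-true⁻ h)) 1≤j)
    brings-above : ∀ i h → rides M j (bringer i h) ∧ above M j s (bringer i h) ≡ true
    brings-above i h with available ex i j (proj₁ (∧-true⁻ h)) 1≤j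
    ... | i′ , ri′ , _ , arrives-before = ∧-true ri′ (dec-true (s ≤? S M i′ j)
          (ℕₚ.≤-trans (does-true (s ≤? S M i j) (proj₂ (∧-true⁻ h)))
                      (travelTime-reflects w v w<v (S-bound M i j) arrives-before)))
    bike-cong : ∀ {x x′} → x ≡ x′ → (rx : entry M x j ≡ true) (rx′ : entry M x′ j ≡ true) →
                bike ex x j rx ≡ bike ex x′ j rx′
    bike-cong refl rx rx′ = cong (bike ex _ j) (Decidable⇒UIP.≡-irrelevant Bool._≟_ rx rx′)
    bringer-injective : ∀ i i′ h h′ → bringer i h ≡ bringer i′ h′ → i ≡ i′
    bringer-injective i i′ h h′ eq
      with available ex i j (proj₁ (∧-true⁻ h)) 1≤j | available ex i′ j (proj₁ (∧-true⁻ h′)) 1≤j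
    ... | x , rx , same-bike , _ | x′ , rx′ , same-bike′ , _ =
      oneRider ex (suc j) i i′ _ _ (trans (sym same-bike) (trans (bike-cong eq rx rx′) same-bike′))

  hall⇒execution : ∀ {k} → Uniform k M → (∀ j → 1 ≤ j → suc j ≤ n → HallCondition M j) →
                   Execution w v M k
  hall⇒execution {k} U hall = record { bike = bike′ ; oneRider = oneRider′ ; available = available′ }
    where
    rank<k : ∀ {j i} → rides M j i ≡ true → rank j i < k
    rank<k {j} {i} ri = let 1≤j , j≤n = entry-bounds M i j ri in
      subst (rank j i <_) (card-rides M U 1≤j j≤n) (StageRanking.rank<card M j ri)
    bike′ : ∀ i j → entry M i j ≡ true → Fin k
    bike′ i j ri = fromℕ< (rank<k {j} ri)
    oneRider′ : ∀ j i i′ ri ri′ → bike′ i j ri ≡ bike′ i′ j ri′ → i ≡ i′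
    oneRider′ j i i′ ri ri′ eq =
      StageRanking.rank-injective M j ri ri′
        (Finₚ.fromℕ<-injective _ _ (rank<k {j} ri) (rank<k {j} ri′) eq)
    available′ : ∀ i j (ri : entry M i (suc j) ≡ true) → 1 ≤ j →
                 Σ (Fin n) λ i′ → Σ (entry M i′ j ≡ true) λ ri′ →
                   (bike′ i′ j ri′ ≡ bike′ i (suc j) ri) × (arrival w v M i′ j ℚ.≤ arrival w v M i j)
    available′ i j ri 1≤j with 1+j≤n ← proj₂ (entry-bounds M i (suc j) ri)
      with StageRanking.rank-surjective M j
             (subst (rank (suc j) i <_) (sym (card-rides M U 1≤j (ℕₚ.<⇒≤ 1+j≤n))) (rank<k ri))
    ... | i′ , ri′ , same-rank =
      i′ , ri′ , Finₚ.fromℕ<-cong _ _ same-rank _ _ ,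
      travelTime-antitone w v w<v (hall⇒same-rank⇒S≤ M (hall j 1≤j 1+j≤n) ri same-rank) (S-bound M i′ j)

theorem3p7 : (n k : ℕ) (M : Matrix n) (w v : ℚ) .{{_ : Positive w}} .{{_ : Positive v}} →
    w ℚ.< v → Uniform k M →
    (Optimal w v M → ∀ j → 1 ≤ j → suc j ≤ n → Dyck (canonicalWord M j)) ×
    ((∀ j → 1 ≤ j → suc j ≤ n → Dyck (canonicalWord M j)) → Optimal w v M)
theorem3p7 n k M w v w<v U =
    (λ (_ , _ , ex) j 1≤j 1+j≤n → from (dyck⇔hall M U 1≤j 1+j≤n) (execution⇒hall w v w<v M ex 1≤j))
  , (λ dyck → k , U , hall⇒execution w v w<v M U
                        (λ j 1≤j 1+j≤n → to (dyck⇔hall M U 1≤j 1+j≤n) (dyck j 1≤j 1+j≤n)))
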